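{- Let $\mathcal{F}=(F,\{R_a\}_{a\in A})$ be an $A$-frame and $\mathcal{G}=(G,\{S_b\}_{b\in B})$ a $B$-frame with $G\subseteq F$, let $p$ be a variable not in $Prop$, and let $\Psi=\{\psi_b\in\mathsf{L}_\mu[p,q]\mid b\in B\}$. If $\mathcal{G}$ is $p$-defined in $\mathcal{F}$ by $\Psi$, then for every valuation $v:Prop\to P(F)$ and every $B$-formula $\phi$ (with free variables in $Prop$), $[\![\phi]\!]_{\mathcal{G}_{\pi\circ v}}=[\![\mathrm{tr}_\Psi(\phi)]\!]_{\mathcal{F}_v[p\mapsto G]}$.
   Context: A frame over actions $A$ is a set with a relation $R_a$ for each $a\in A$; $\mathcal{F}_v$ is the model obtained by adding valuation $v$, and $\mathcal{F}_v[p\mapsto G]$ changes the value of $p$ to $G$. $\mathsf{L}_\mu$ is the modal $\mu$-calculus ($\phi ::= y \mid \neg y \mid \top \mid \phi\wedge\phi \mid \bot \mid \phi\vee\phi \mid \langle a\rangle\phi \mid [a]\phi \mid \mu_z.\phi \mid \nu_z.\phi$, standard semantics); $\mathsf{L}_\mu[p,q]$ denotes $A$-formulas whose only free variables are $p,q$, both occurring positively. $\pi:P(F)\to P(G)$, $\pi(S)=S\cap G$, and $(\pi\circ v)(y)=G\cap v(y)$. $\mathcal{G}$ is $p$-defined in $\mathcal{F}$ by $\Psi$ if for each $b\in B$ and $S\subseteq F$: $\{s\in G\mid\exists s'\in G\cap S,\ sS_bs'\}=[\![\psi_b]\!]_{\mathcal{F}_{[G/p,S/q]}}$, where $[G/p,S/q]$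 sends $p$ to $G$, $q$ to $S$ and other variables to $\emptyset$. For each $b$, $\psi_b^{op}$ is a formula (in the negation-normal grammar) semantically equivalent to $\neg\psi_b[\neg q/q]$. The translation $\mathrm{tr}_\Psi$ from $B$-formulas to $A$-formulas: $\mathrm{tr}(y)=p\wedge y$, $\mathrm{tr}(\neg y)=p\wedge\neg y$, $\mathrm{tr}(\bot)=\bot$, $\mathrm{tr}(\top)=p$, $\mathrm{tr}(\psi_0\,@\,\psi_1)=\mathrm{tr}(\psi_0)\,@\,\mathrm{tr}(\psi_1)$ ($@\in\{\wedge,\vee\}$), $\mathrm{tr}(\langle b\rangle\psi)=\psi_b[\mathrm{tr}(\psi)/q]$, $\mathrm{tr}([b]\psi)=p\wedge\psi_b^{op}[\mathrm{tr}(\psi)/q]$, $\mathrm{tr}(\mu_z.\psi)=\mu_z.\mathrm{tr}(\psi)$, $\mathrm{tr}(\nu_z.\psi)=\nu_z.\mathrm{tr}(\psi)$. -}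

module Defs where

import Level
open import Level using (0ℓ; Lift)
open import Data.Sum using (_⊎_)
open import Data.Maybe using (Maybe; just; nothing)
open import Data.Product using (Σ; _×_; _,_; ∃)
open import Data.Empty using (⊥)
open import Data.Unit using (⊤)
open import Relation.Unary using (Pred)
open import Relation.Nullary using (¬_)
open import Relation.Binary.PropositionalEquality using (_≡_)
open import Function.Bundles using (_⇔_)

record Frame (A : Set) : Set₁ where
  field
    Carrier : Set
    R       : A → Carrier → Carrier → Set

open Frame public

Sub : Set → Set₁
Sub X = Pred X 0ℓ

_≐_ : {X : Set} → Sub X → Sub X → Set
S ≐ T = ∀ x → (S x ⇔ T x)

_⊆′_ : {X : Set} → Sub X → Sub X → Set
S ⊆′ T = ∀ x → S x → T x

∁′ : {X : Set} → Sub X → Sub X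
∁′ S x = ¬ S x

-- Variables are well-scoped: a formula of  Form A V  has its free
-- variables in V; a fixpoint binder binds  nothing : Maybe V.
-- (This makes substitution capture-avoiding, i.e. formulas up to α.)

data Form (A : Set) (V : Set) : Set where
  var  : V → Form A V
  neg  : V → Form A V
  tt   : Form A V
  _∧_  : Form A V → Form A V → Form A V
  ff   : Form A V
  _∨_  : Form A V → Form A V → Form A V
  ⟨_⟩_ : A → Form A V → Form A V
  [_]_ : A → Form A V → Form A V
  μ    : Form A (Maybe V) → Form A V
  ν    : Form A (Maybe V) → Form A V

mapMaybe : {V W : Set} → (V → W) → Maybe V → Maybe W
mapMaybe f nothing  = nothing
mapMaybe f (just x) = just (f x)

rename : {A V W : Set} → (V → W) → Form A V → Form A W
rename f (var x)   = var (f x)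
rename f (neg x)   = neg (f x)
rename f tt        = tt
rename f (φ ∧ ψ)   = rename f φ ∧ rename f ψ
rename f ff        = ff
rename f (φ ∨ ψ)   = rename f φ ∨ rename f ψ
rename f (⟨ a ⟩ φ) = ⟨ a ⟩ rename f φ
rename f ([ a ] φ) = [ a ] rename f φ
rename f (μ φ)     = μ (rename (mapMaybe f) φ)
rename f (ν φ)     = ν (rename (mapMaybe f) φ)

liftσ : {A V W : Set} → (Maybe W → Form A (Maybe W)) →
        (V → Form A W) → Maybe V → Form A (Maybe W)
liftσ b σ nothing  = b nothing
liftσ b σ (just x) = rename just (σ x)

subst : {A V W : Set} → (V → Form A W) → (V → Form A W) →
        Form A V → Form A W
subst σ⁺ σ⁻ (var x)   = σ⁺ x
subst σ⁺ σ⁻ (neg x)   = σ⁻ x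
subst σ⁺ σ⁻ tt        = tt
subst σ⁺ σ⁻ (φ ∧ ψ)   = subst σ⁺ σ⁻ φ ∧ subst σ⁺ σ⁻ ψ
subst σ⁺ σ⁻ ff        = ff
subst σ⁺ σ⁻ (φ ∨ ψ)   = subst σ⁺ σ⁻ φ ∨ subst σ⁺ σ⁻ ψ
subst σ⁺ σ⁻ (⟨ a ⟩ φ) = ⟨ a ⟩ subst σ⁺ σ⁻ φ
subst σ⁺ σ⁻ ([ a ] φ) = [ a ] subst σ⁺ σ⁻ φ
subst σ⁺ σ⁻ (μ φ)     = μ (subst (liftσ var σ⁺) (liftσ neg σ⁻) φ)
subst σ⁺ σ⁻ (ν φ)     = ν (subst (liftσ var σ⁺) (liftσ neg σ⁻) φ)

liftP : {V : Set} → (V → Set) → Maybe V → Set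
liftP P nothing  = ⊥
liftP P (just x) = P x

NoNeg : {A V : Set} → (V → Set) → Form A V → Set
NoNeg P (var x)   = ⊤
NoNeg P (neg x)   = ¬ P x
NoNeg P tt        = ⊤
NoNeg P (φ ∧ ψ)   = NoNeg P φ × NoNeg P ψ
NoNeg P ff        = ⊤
NoNeg P (φ ∨ ψ)   = NoNeg P φ × NoNeg P ψ
NoNeg P (⟨ a ⟩ φ) = NoNeg P φ
NoNeg P ([ a ] φ) = NoNeg P φ
NoNeg P (μ φ)     = NoNeg (liftP P) φ
NoNeg P (ν φ)     = NoNeg (liftP P) φ

Bound : {V : Set} → Maybe V → Set
Bound nothing  = ⊤
Bound (just _) = ⊥

WF : {A V : Set} → Form A V → Set
WF (var x)   = ⊤
WF (neg x)   = ⊤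
WF tt        = ⊤
WF (φ ∧ ψ)   = WF φ × WF ψ
WF ff        = ⊤
WF (φ ∨ ψ)   = WF φ × WF ψ
WF (⟨ a ⟩ φ) = WF φ
WF ([ a ] φ) = WF φ
WF (μ φ)     = WF φ × NoNeg Bound φ
WF (ν φ)     = WF φ × NoNeg Bound φ

-- Since the powerset of a type is not a set predicatively,
-- the semantics is given relationally:  Sem 𝔉 φ ρ X  means
-- "[[φ]] in the model 𝔉_ρ is (extensionally) the set X".
-- Least / greatest fixpoints are characterised as in Knaster–Tarski.

_[↦_] : {C V : Set} → (V → Sub C) → Sub C → Maybe V → Sub C
(ρ [↦ Y ]) nothing  = Y
(ρ [↦ Y ]) (just x) = ρ x

↑ : Set → Set₁
↑ X = Lift (Level.suc 0ℓ) X

Sem : {A : Set} (𝔉 : Frame A) {V : Set} →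
      Form A V → (V → Sub (Carrier 𝔉)) → Sub (Carrier 𝔉) → Set₁
Sem 𝔉 (var x) ρ X = ↑ (X ≐ ρ x)
Sem 𝔉 (neg x) ρ X = ↑ (X ≐ ∁′ (ρ x))
Sem 𝔉 tt ρ X = ↑ (X ≐ λ _ → ⊤)
Sem 𝔉 ff ρ X = ↑ (X ≐ λ _ → ⊥)
Sem 𝔉 (φ ∧ ψ) ρ X = Σ (Sub (Carrier 𝔉)) λ Y → Σ (Sub (Carrier 𝔉)) λ Z →
  Sem 𝔉 φ ρ Y × Sem 𝔉 ψ ρ Z × ↑ (X ≐ λ s → Y s × Z s)
Sem 𝔉 (φ ∨ ψ) ρ X = Σ (Sub (Carrier 𝔉)) λ Y → Σ (Sub (Carrier 𝔉)) λ Z →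
  Sem 𝔉 φ ρ Y × Sem 𝔉 ψ ρ Z × ↑ (X ≐ λ s → Y s ⊎ Z s)
Sem 𝔉 (⟨ a ⟩ φ) ρ X = Σ (Sub (Carrier 𝔉)) λ Y →
  Sem 𝔉 φ ρ Y × ↑ (X ≐ λ s → ∃ λ s′ → R 𝔉 a s s′ × Y s′)
Sem 𝔉 ([ a ] φ) ρ X = Σ (Sub (Carrier 𝔉)) λ Y →
  Sem 𝔉 φ ρ Y × ↑ (X ≐ λ s → ∀ s′ → R 𝔉 a s s′ → Y s′)
Sem 𝔉 (μ φ) ρ X =
  (Σ (Sub (Carrier 𝔉)) λ X′ → Sem 𝔉 φ (ρ [↦ X ]) X′ × ↑ (X′ ≐ X))
  × (∀ Y Y′ → Sem 𝔉 φ (ρ [↦ Y ]) Y′ → ↑ (Y′ ⊆′ Y → X ⊆′ Y))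
Sem 𝔉 (ν φ) ρ X =
  (Σ (Sub (Carrier 𝔉)) λ X′ → Sem 𝔉 φ (ρ [↦ X ]) X′ × ↑ (X′ ≐ X))
  × (∀ Y Y′ → Sem 𝔉 φ (ρ [↦ Y ]) Y′ → ↑ (Y ⊆′ Y′ → Y ⊆′ X))

data PQ : Set where
  p q : PQ

pq : ∀ {ℓ} {X : Set ℓ} → X → X → PQ → X
pq x y p = x
pq x y q = y

InLμpq : {A : Set} → Form A PQ → Set
InLμpq ψ = WF ψ × NoNeg (λ _ → ⊤) ψ

-- The translation tr_Ψ.  tr e p′ maps a B-formula over variables V to an
-- A-formula over W, where e embeds V into W and p′ : W is the variable p.
-- ψ b = ψ_b ,  ψop b = ψ_b^op .  Substitution [T/q] replaces q by T and
-- leaves p (in either polarity) as p.  Negative occurrences of q never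
-- arise under the hypotheses of the theorem (ψ_b and ψ_b^op are positive
-- in q); the placeholder  ff  is used for them.

tr : {A B V W : Set} → (B → Form A PQ) → (B → Form A PQ) →
     (V → W) → W → Form B V → Form A W
tr ψ ψop e p′ (var x)   = var p′ ∧ var (e x)
tr ψ ψop e p′ (neg x)   = var p′ ∧ neg (e x)
tr ψ ψop e p′ ff        = ff
tr ψ ψop e p′ tt        = var p′
tr ψ ψop e p′ (φ ∧ χ)   = tr ψ ψop e p′ φ ∧ tr ψ ψop e p′ χ
tr ψ ψop e p′ (φ ∨ χ)   = tr ψ ψop e p′ φ ∨ tr ψ ψop e p′ χ
tr ψ ψop e p′ (⟨ b ⟩ φ) =
  subst (pq (var p′) (tr ψ ψop e p′ φ)) (pq (neg p′) ff) (ψ b)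
tr ψ ψop e p′ ([ b ] φ) =
  var p′ ∧ subst (pq (var p′) (tr ψ ψop e p′ φ)) (pq (neg p′) ff) (ψop b)
tr ψ ψop e p′ (μ φ)     = μ (tr ψ ψop (mapMaybe e) (just p′) φ)
tr ψ ψop e p′ (ν φ)     = ν (tr ψ ψop (mapMaybe e) (just p′) φ)

-- top level: the variable p is  nothing : Maybe Prop  (so p ∉ Prop)
trΨ : {A B P : Set} → (B → Form A PQ) → (B → Form A PQ) →
      Form B P → Form A (Maybe P)
trΨ ψ ψop = tr ψ ψop just nothing

-- G ⊆ F is represented by an injective map ι : G → F.

image : {G F : Set} → (G → F) → Sub G → Sub F
image ι X x = ∃ λ g → ι g ≡ x × X g

_[p↦_] : {F P : Set} → (P → Sub F) → Sub F → Maybe P → Sub F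
(v [p↦ G ]) nothing  = G
(v [p↦ G ]) (just y) = v y

π∘ : {G F P : Set} → (G → F) → (P → Sub F) → P → Sub G
π∘ ι v y g = v y (ι g)

IsOp : {A : Set} (𝔉 : Frame A) → Form A PQ → Form A PQ → Set₁
IsOp 𝔉 ψ ψ′ = ∀ (ρ : PQ → Sub (Carrier 𝔉)) (X : Sub (Carrier 𝔉)) →
  Sem 𝔉 ψ′ ρ X ⇔ Sem 𝔉 (subst (pq (var p) (neg q)) (pq (neg p) (var q)) ψ) ρ (∁′ X)

PDefined : {A B : Set} (𝔉 : Frame A) (𝔊 : Frame B) →
           (Carrier 𝔊 → Carrier 𝔉) → (B → Form A PQ) → Set₁
PDefined 𝔉 𝔊 ι ψ = ∀ b (S : Sub (Carrier 𝔉)) →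
  Sem 𝔉 (ψ b) (pq (image ι (λ _ → ⊤)) S)
    (image ι (λ s → ∃ λ s′ → S (ι s′) × R 𝔊 b s s′))

-- Read formulas denotationally, with fixpoints given by Knaster–Tarski (classically); for
-- well-formed formulas Sem singles out exactly this denotation. The theorem then says that ι maps
-- ⟦φ⟧ onto ⟦tr φ⟧, which goes by induction on φ under the invariant (Agree) that p denotes G and
-- ι maps the value of every other variable in G onto G ∩ its value in F. Diamonds are p-definability itself; boxes reduce to
-- diamonds through ψ_b^op ≡ ¬ψ_b[¬q/q] and excluded middle; and a least or greatest fixpoint on
-- P(F) matches the one on P(G) because the F-side operator is, on each argument Z, the image of the
-- G-side operator applied to Z ∩ G.

module Submission where

open import Defs
open import Level using (0ℓ; suc; lift; lower)
open import Axiom.ExcludedMiddle using (ExcludedMiddle)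
open import Axiom.DoubleNegationElimination using (em⇒dne)
open import Data.Empty using (⊥; ⊥-elim)
open import Data.Maybe using (Maybe; just; nothing)
open import Data.Product as Product using (Σ; _×_; _,_; proj₁; proj₂; ∃)
open import Data.Sum as Sum using (inj₁; inj₂)
open import Data.Unit using (⊤; tt)
open import Function using (_∘_; id; mk⇔; Equivalence)
open import Function.Definitions using (Injective)
open import Relation.Binary.Core using (_Preserves_⟶_)
open import Relation.Binary.PropositionalEquality using (_≡_; refl)
open import Relation.Nullary using (¬_)
open import Relation.Nullary.Decidable using (True; toWitness; fromWitness)
open import Relation.Unary using (_⊆_; _∩_; _∪_; ∁) renaming (_≐_ to _≈_)
open import Relation.Unary.Properties using ()
  renaming (≐-refl to ≈-refl; ≐-sym to ≈-sym; ≐-trans to ≈-trans)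
open import Relation.Unary.Algebra using (∩-cong; ∪-cong)
open import Relation.Unary.Relation.Binary.Equality using (≐-setoid)
import Relation.Binary.Reasoning.Setoid as SetoidReasoning

private
  variable
    A B C D G F V W : Set

≐⇒≈ : {S T : Sub C} → S ≐ T → S ≈ T
≐⇒≈ S≐T = (λ {x} → Equivalence.to (S≐T x)) , (λ {x} → Equivalence.from (S≐T x))

≈⇒≐ : {S T : Sub C} → S ≈ T → S ≐ T
≈⇒≐ (S⊆T , T⊆S) x = mk⇔ S⊆T T⊆S

mono⇒cong : {H : Sub C → Sub D} → H Preserves _⊆_ ⟶ _⊆_ → H Preserves _≈_ ⟶ _≈_
mono⇒cong H-mono (S⊆T , T⊆S) = H-mono S⊆T , H-mono T⊆S

∁-cong : {S T : Sub C} → S ≈ T → ∁ S ≈ ∁ T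
∁-cong (S⊆T , T⊆S) = (λ ¬s t → ¬s (T⊆S t)) , (λ ¬t s → ¬t (S⊆T s))

◇ : (C → C → Set) → Sub C → Sub C
◇ R Y s = ∃ λ s′ → R s s′ × Y s′

□ : (C → C → Set) → Sub C → Sub C
□ R Y s = ∀ s′ → R s s′ → Y s′

module _ (R : C → C → Set) where

  ◇-mono : ◇ R Preserves _⊆_ ⟶ _⊆_
  ◇-mono Y⊆Z = Product.map₂ (Product.map₂ Y⊆Z)

  □-mono : □ R Preserves _⊆_ ⟶ _⊆_
  □-mono Y⊆Z y s′ r = Y⊆Z (y s′ r)

  ◇-cong : ◇ R Preserves _≈_ ⟶ _≈_
  ◇-cong = mono⇒cong ◇-mono

  □-cong : □ R Preserves _≈_ ⟶ _≈_
  □-cong = mono⇒cong □-mono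

[↦]-⊆ : {ρ ρ′ : V → Sub C} {Y : Sub C} →
  (∀ x → ρ x ⊆ ρ′ x) → ∀ y → (ρ [↦ Y ]) y ⊆ (ρ′ [↦ Y ]) y
[↦]-⊆ up nothing  = id
[↦]-⊆ up (just x) = up x

[↦]-⊇ : {P : V → Set} {ρ ρ′ : V → Sub C} {Y : Sub C} →
  (∀ x → ¬ P x → ρ′ x ⊆ ρ x) → ∀ y → ¬ liftP P y → (ρ′ [↦ Y ]) y ⊆ (ρ [↦ Y ]) y
[↦]-⊇ down nothing  _ = id
[↦]-⊇ down (just x)   = down x

module Image (ι : G → F) where

  range : Sub F
  range = image ι (λ _ → ⊤)

  image-mono : image ι Preserves _⊆_ ⟶ _⊆_
  image-mono X⊆Y (g , refl , x) = g , refl , X⊆Y x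

  image-cong : image ι Preserves _≈_ ⟶ _≈_
  image-cong = mono⇒cong image-mono

  image-∪ : {X Y : Sub G} → image ι (X ∪ Y) ≈ image ι X ∪ image ι Y
  image-∪ =
      (λ { (g , refl , inj₁ x) → inj₁ (g , refl , x)
         ; (g , refl , inj₂ y) → inj₂ (g , refl , y) })
    , (λ { (inj₁ (g , refl , x)) → g , refl , inj₁ x
         ; (inj₂ (g , refl , y)) → g , refl , inj₂ y })

  image-∅ : image ι (λ _ → ⊥) ≈ (λ _ → ⊥)
  image-∅ = (λ ()) ∘ proj₂ ∘ proj₂ , λ ()

  image-preimage : (Z : Sub F) → image ι (Z ∘ ι) ≈ range ∩ Z
  image-preimage Z = (λ { (g , refl , z) → (g , refl , tt) , z })
                   , (λ { ((g , refl , _) , z) → g , refl , z })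

  image≈range∩image : {X : Sub G} → image ι X ≈ range ∩ image ι X
  image≈range∩image = (λ { x@(g , refl , _) → (g , refl , tt) , x }) , proj₂

  module Embedding (ι-injective : Injective _≡_ _≡_ ι) where

    ∈-image⇒∈ : {X : Sub G} {g : G} → image ι X (ι g) → X g
    ∈-image⇒∈ (g′ , ιg′≡ιg , x) with ι-injective ιg′≡ιg
    ... | refl = x

    image-∩ : {X Y : Sub G} → image ι (X ∩ Y) ≈ image ι X ∩ image ι Y
    image-∩ = (λ { (g , refl , x , y) → (g , refl , x) , (g , refl , y) })
            , (λ { ((g , refl , x) , y) → g , refl , x , ∈-image⇒∈ y })

    image-∁ : {Y : Sub G} {Z : Sub F} → image ι Y ≈ range ∩ Z → image ι (∁ Y) ≈ range ∩ ∁ Z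
    image-∁ (Y⊆Z , Z⊆Y) =
        (λ { (g , refl , ¬y) → (g , refl , tt) , λ z → ¬y (∈-image⇒∈ (Z⊆Y ((g , refl , tt) , z))) })
      , (λ { ((g , refl , _) , ¬z) → g , refl , λ y → ¬z (proj₂ (Y⊆Z (g , refl , y))) })

    image≈⇒≈preimage : {X : Sub G} {Z : Sub F} → image ι X ≈ Z → X ≈ Z ∘ ι
    image≈⇒≈preimage (X⊆Z , Z⊆X) = (λ x → X⊆Z (_ , refl , x)) , (λ z → ∈-image⇒∈ (Z⊆X z))

module Classical (em : ExcludedMiddle (suc 0ℓ)) where

  dne : {P : Set} → ¬ ¬ P → P
  dne ¬¬p = lower (em⇒dne em λ ¬p↑ → ¬¬p (¬p↑ ∘ lift))

  ∁∁ : {S : Sub C} → ∁ (∁ S) ≈ S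
  ∁∁ = dne , λ s ¬s → ¬s s

  -- Knaster–Tarski, impredicatively: excluded middle at level 1 turns the
  -- large conditions below into small propositions.
  lfp : (Sub C → Sub C) → Sub C
  lfp Φ s = True (em {∀ Y → Φ Y ⊆ Y → Y s})

  gfp : (Sub C → Sub C) → Sub C
  gfp Φ s = True (em {Σ (Sub _) λ Y → Y ⊆ Φ Y × Y s})

  module _ {Φ : Sub C → Sub C} where

    lfp-intro : {s : C} → (∀ Y → Φ Y ⊆ Y → Y s) → lfp Φ s
    lfp-intro = fromWitness

    lfp-induction : {Y : Sub C} → Φ Y ⊆ Y → lfp Φ ⊆ Y
    lfp-induction ΦY⊆Y s∈ = toWitness {a? = em} s∈ _ ΦY⊆Y

    gfp-coinduction : {Y : Sub C} → Y ⊆ Φ Y → Y ⊆ gfp Φ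
    gfp-coinduction {Y} Y⊆ΦY y = fromWitness (Y , (λ {_} → Y⊆ΦY) , y)

    gfp-elim : {s : C} → gfp Φ s → Σ (Sub C) λ Y → Y ⊆ Φ Y × Y s
    gfp-elim = toWitness {a? = em}

    module _ (Φ-mono : Φ Preserves _⊆_ ⟶ _⊆_) where

      lfp-fold : Φ (lfp Φ) ⊆ lfp Φ
      lfp-fold x = lfp-intro λ Y ΦY⊆Y → ΦY⊆Y (Φ-mono (lfp-induction ΦY⊆Y) x)

      gfp-unfold : gfp Φ ⊆ Φ (gfp Φ)
      gfp-unfold x with gfp-elim x
      ... | Y , Y⊆ΦY , y = Φ-mono (gfp-coinduction Y⊆ΦY) (Y⊆ΦY y)

      lfp-fixed : Φ (lfp Φ) ≈ lfp Φ
      lfp-fixed = lfp-fold , lfp-induction (Φ-mono lfp-fold)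

      gfp-fixed : Φ (gfp Φ) ≈ gfp Φ
      gfp-fixed = gfp-coinduction (Φ-mono gfp-unfold) , gfp-unfold

  lfp-mono : {Φ Ψ : Sub C → Sub C} → (∀ Y → Φ Y ⊆ Ψ Y) → lfp Φ ⊆ lfp Ψ
  lfp-mono Φ⊆Ψ x = lfp-intro λ Y ΨY⊆Y → lfp-induction (ΨY⊆Y ∘ Φ⊆Ψ Y) x

  gfp-mono : {Φ Ψ : Sub C → Sub C} → (∀ Y → Φ Y ⊆ Ψ Y) → gfp Φ ⊆ gfp Ψ
  gfp-mono Φ⊆Ψ x with gfp-elim x
  ... | Y , Y⊆ΦY , y = gfp-coinduction (Φ⊆Ψ Y ∘ Y⊆ΦY) y

  lfp-cong : {Φ Ψ : Sub C → Sub C} → (∀ Y → Φ Y ≈ Ψ Y) → lfp Φ ≈ lfp Ψ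
  lfp-cong Φ≈Ψ = lfp-mono (proj₁ ∘ Φ≈Ψ) , lfp-mono (proj₂ ∘ Φ≈Ψ)

  gfp-cong : {Φ Ψ : Sub C → Sub C} → (∀ Y → Φ Y ≈ Ψ Y) → gfp Φ ≈ gfp Ψ
  gfp-cong Φ≈Ψ = gfp-mono (proj₁ ∘ Φ≈Ψ) , gfp-mono (proj₂ ∘ Φ≈Ψ)

  module _ (ι : G → F) where
    open Image ι

    image-lfp : {Φ : Sub G → Sub G} {Ψ : Sub F → Sub F} → Φ Preserves _⊆_ ⟶ _⊆_ →
      (∀ {Y Z} → image ι Y ≈ range ∩ Z → image ι (Φ Y) ≈ Ψ Z) →
      image ι (lfp Φ) ≈ lfp Ψ
    image-lfp {Φ} {Ψ} Φ-mono commute = image-lfp⊆ , lfp-induction Ψ-image⊆image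
      where
      image-lfp⊆ : image ι (lfp Φ) ⊆ lfp Ψ
      image-lfp⊆ (g , refl , x) = lfp-intro λ Z ΨZ⊆Z →
        lfp-induction (λ y → ΨZ⊆Z (proj₁ (commute (image-preimage Z)) (_ , refl , y))) x
      Ψ-image⊆image : Ψ (image ι (lfp Φ)) ⊆ image ι (lfp Φ)
      Ψ-image⊆image z = image-mono (lfp-fold Φ-mono) (proj₂ (commute image≈range∩image) z)

    module _ (ι-injective : Injective _≡_ _≡_ ι) where
      open Embedding ι-injective

      image-gfp : {Φ : Sub G → Sub G} {Ψ : Sub F → Sub F} → Φ Preserves _⊆_ ⟶ _⊆_ →
        (∀ {Y Z} → image ι Y ≈ range ∩ Z → image ι (Φ Y) ≈ Ψ Z) →
        image ι (gfp Φ) ≈ gfp Ψ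
      image-gfp {Φ} {Ψ} Φ-mono commute =
        gfp-coinduction (proj₁ (commute image≈range∩image) ∘ image-mono (gfp-unfold Φ-mono)) ,
        gfp⊆image
        where
        gfp⊆image : gfp Ψ ⊆ image ι (gfp Φ)
        gfp⊆image u with gfp-elim u
        ... | Z , Z⊆ΨZ , z with proj₂ (commute (image-preimage Z)) (Z⊆ΨZ z)
        ... | g , refl , _ =
          g , refl , gfp-coinduction (∈-image⇒∈ ∘ proj₂ (commute (image-preimage Z)) ∘ Z⊆ΨZ) z

      image-□ : {R : G → G → Set} {Y : Sub G} →
        range ∩ ∁ (image ι (◇ R (∁ Y))) ≈ image ι (□ R Y)
      image-□ =
          (λ { ((g , refl , _) , ¬◇¬y) → g , refl , λ g′ r →
                 dne λ ¬y → ¬◇¬y (g , refl , g′ , r , ¬y) })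
        , (λ { (g , refl , □y) → (g , refl , tt) , λ ◇¬y →
                 let (g′ , r , ¬y) = ∈-image⇒∈ ◇¬y in ¬y (□y g′ r) })

liftP-empty : {P : V → Set} → (∀ x → ¬ P x) → ∀ y → ¬ liftP P y
liftP-empty ¬P nothing  ()
liftP-empty ¬P (just x) = ¬P x

liftP-comap : {P : V → Set} {Q : W → Set} (f : V → W) →
  (∀ x → Q (f x) → P x) → ∀ y → liftP Q (mapMaybe f y) → liftP P y
liftP-comap f Q⇒P (just x) = Q⇒P x

Bound-mapMaybe : (f : V → W) → ∀ y → Bound (mapMaybe f y) → Bound y
Bound-mapMaybe f nothing _ = tt

NoNeg-empty : {P : V → Set} → (∀ x → ¬ P x) → (φ : Form A V) → NoNeg P φ
NoNeg-empty ¬P (var x)   = tt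
NoNeg-empty ¬P (neg x)   = ¬P x
NoNeg-empty ¬P tt        = tt
NoNeg-empty ¬P (φ ∧ χ)   = NoNeg-empty ¬P φ , NoNeg-empty ¬P χ
NoNeg-empty ¬P ff        = tt
NoNeg-empty ¬P (φ ∨ χ)   = NoNeg-empty ¬P φ , NoNeg-empty ¬P χ
NoNeg-empty ¬P (⟨ a ⟩ φ) = NoNeg-empty ¬P φ
NoNeg-empty ¬P ([ a ] φ) = NoNeg-empty ¬P φ
NoNeg-empty ¬P (μ φ)     = NoNeg-empty (liftP-empty ¬P) φ
NoNeg-empty ¬P (ν φ)     = NoNeg-empty (liftP-empty ¬P) φ

NoNeg-rename : {P : V → Set} {Q : W → Set} (f : V → W) → (∀ x → Q (f x) → P x) →
  (φ : Form A V) → NoNeg P φ → NoNeg Q (rename f φ)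
NoNeg-rename f Q⇒P (var x)   n       = tt
NoNeg-rename f Q⇒P (neg x)   ¬Px     = ¬Px ∘ Q⇒P x
NoNeg-rename f Q⇒P tt        n       = tt
NoNeg-rename f Q⇒P (φ ∧ χ)   (n , m) = NoNeg-rename f Q⇒P φ n , NoNeg-rename f Q⇒P χ m
NoNeg-rename f Q⇒P ff        n       = tt
NoNeg-rename f Q⇒P (φ ∨ χ)   (n , m) = NoNeg-rename f Q⇒P φ n , NoNeg-rename f Q⇒P χ m
NoNeg-rename f Q⇒P (⟨ a ⟩ φ) n       = NoNeg-rename f Q⇒P φ n
NoNeg-rename f Q⇒P ([ a ] φ) n       = NoNeg-rename f Q⇒P φ n
NoNeg-rename f Q⇒P (μ φ)     n       = NoNeg-rename (mapMaybe f) (liftP-comap f Q⇒P) φ n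
NoNeg-rename f Q⇒P (ν φ)     n       = NoNeg-rename (mapMaybe f) (liftP-comap f Q⇒P) φ n

NoNeg-Bound-rename-just : (φ : Form A V) → NoNeg Bound (rename just φ)
NoNeg-Bound-rename-just φ =
  NoNeg-rename {P = λ _ → ⊥} just (λ _ ()) φ (NoNeg-empty (λ _ ()) φ)

WF-rename : (f : V → W) (φ : Form A V) → WF φ → WF (rename f φ)
WF-rename f (var x)   w       = tt
WF-rename f (neg x)   w       = tt
WF-rename f tt        w       = tt
WF-rename f (φ ∧ χ)   (w , u) = WF-rename f φ w , WF-rename f χ u
WF-rename f ff        w       = tt
WF-rename f (φ ∨ χ)   (w , u) = WF-rename f φ w , WF-rename f χ u
WF-rename f (⟨ a ⟩ φ) w       = WF-rename f φ w
WF-rename f ([ a ] φ) w       = WF-rename f φ w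
WF-rename f (μ φ)     (w , n) =
  WF-rename (mapMaybe f) φ w , NoNeg-rename (mapMaybe f) (Bound-mapMaybe f) φ n
WF-rename f (ν φ)     (w , n) =
  WF-rename (mapMaybe f) φ w , NoNeg-rename (mapMaybe f) (Bound-mapMaybe f) φ n

NoNeg-liftσ⁺ : {Q : W → Set} (σ⁺ : V → Form A W) → (∀ x → NoNeg Q (σ⁺ x)) →
  ∀ y → NoNeg (liftP Q) (liftσ var σ⁺ y)
NoNeg-liftσ⁺ σ⁺ n⁺ nothing  = tt
NoNeg-liftσ⁺ σ⁺ n⁺ (just x) = NoNeg-rename just (λ _ → id) (σ⁺ x) (n⁺ x)

NoNeg-liftσ⁻ : {P : V → Set} {Q : W → Set} (σ⁻ : V → Form A W) →
  (∀ x → ¬ P x → NoNeg Q (σ⁻ x)) → ∀ y → ¬ liftP P y → NoNeg (liftP Q) (liftσ neg σ⁻ y)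
NoNeg-liftσ⁻ σ⁻ n⁻ nothing  _   = λ ()
NoNeg-liftσ⁻ σ⁻ n⁻ (just x) ¬Px = NoNeg-rename just (λ _ → id) (σ⁻ x) (n⁻ x ¬Px)

NoNeg-subst : {P : V → Set} {Q : W → Set} (σ⁺ σ⁻ : V → Form A W) (φ : Form A V) → NoNeg P φ →
  (∀ x → NoNeg Q (σ⁺ x)) → (∀ x → ¬ P x → NoNeg Q (σ⁻ x)) → NoNeg Q (subst σ⁺ σ⁻ φ)
NoNeg-subst σ⁺ σ⁻ (var x)   n       n⁺ n⁻ = n⁺ x
NoNeg-subst σ⁺ σ⁻ (neg x)   ¬Px     n⁺ n⁻ = n⁻ x ¬Px
NoNeg-subst σ⁺ σ⁻ tt        n       n⁺ n⁻ = tt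
NoNeg-subst σ⁺ σ⁻ (φ ∧ χ)   (n , m) n⁺ n⁻ = NoNeg-subst σ⁺ σ⁻ φ n n⁺ n⁻ , NoNeg-subst σ⁺ σ⁻ χ m n⁺ n⁻
NoNeg-subst σ⁺ σ⁻ ff        n       n⁺ n⁻ = tt
NoNeg-subst σ⁺ σ⁻ (φ ∨ χ)   (n , m) n⁺ n⁻ = NoNeg-subst σ⁺ σ⁻ φ n n⁺ n⁻ , NoNeg-subst σ⁺ σ⁻ χ m n⁺ n⁻
NoNeg-subst σ⁺ σ⁻ (⟨ a ⟩ φ) n       n⁺ n⁻ = NoNeg-subst σ⁺ σ⁻ φ n n⁺ n⁻
NoNeg-subst σ⁺ σ⁻ ([ a ] φ) n       n⁺ n⁻ = NoNeg-subst σ⁺ σ⁻ φ n n⁺ n⁻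
NoNeg-subst σ⁺ σ⁻ (μ φ)     n       n⁺ n⁻ =
  NoNeg-subst (liftσ var σ⁺) (liftσ neg σ⁻) φ n (NoNeg-liftσ⁺ σ⁺ n⁺) (NoNeg-liftσ⁻ σ⁻ n⁻)
NoNeg-subst σ⁺ σ⁻ (ν φ)     n       n⁺ n⁻ =
  NoNeg-subst (liftσ var σ⁺) (liftσ neg σ⁻) φ n (NoNeg-liftσ⁺ σ⁺ n⁺) (NoNeg-liftσ⁻ σ⁻ n⁻)

NoNeg-Bound-subst : (σ⁺ σ⁻ : V → Form A W) (φ : Form A (Maybe V)) → NoNeg Bound φ →
  NoNeg Bound (subst (liftσ var σ⁺) (liftσ neg σ⁻) φ)
NoNeg-Bound-subst σ⁺ σ⁻ φ n = NoNeg-subst _ _ φ n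
  (λ { nothing → tt ; (just x) → NoNeg-Bound-rename-just (σ⁺ x) })
  (λ { nothing ¬b → ⊥-elim (¬b tt) ; (just x) _ → NoNeg-Bound-rename-just (σ⁻ x) })

WF-liftσ : {b : Maybe W → Form A (Maybe W)} (σ : V → Form A W) →
  WF (b nothing) → (∀ x → WF (σ x)) → ∀ y → WF (liftσ b σ y)
WF-liftσ σ wb wσ nothing  = wb
WF-liftσ σ wb wσ (just x) = WF-rename just (σ x) (wσ x)

WF-subst : (σ⁺ σ⁻ : V → Form A W) (φ : Form A V) → WF φ →
  (∀ x → WF (σ⁺ x)) → (∀ x → WF (σ⁻ x)) → WF (subst σ⁺ σ⁻ φ)
WF-subst σ⁺ σ⁻ (var x)   w       w⁺ w⁻ = w⁺ x
WF-subst σ⁺ σ⁻ (neg x)   w       w⁺ w⁻ = w⁻ x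
WF-subst σ⁺ σ⁻ tt        w       w⁺ w⁻ = tt
WF-subst σ⁺ σ⁻ (φ ∧ χ)   (w , u) w⁺ w⁻ = WF-subst σ⁺ σ⁻ φ w w⁺ w⁻ , WF-subst σ⁺ σ⁻ χ u w⁺ w⁻
WF-subst σ⁺ σ⁻ ff        w       w⁺ w⁻ = tt
WF-subst σ⁺ σ⁻ (φ ∨ χ)   (w , u) w⁺ w⁻ = WF-subst σ⁺ σ⁻ φ w w⁺ w⁻ , WF-subst σ⁺ σ⁻ χ u w⁺ w⁻
WF-subst σ⁺ σ⁻ (⟨ a ⟩ φ) w       w⁺ w⁻ = WF-subst σ⁺ σ⁻ φ w w⁺ w⁻
WF-subst σ⁺ σ⁻ ([ a ] φ) w       w⁺ w⁻ = WF-subst σ⁺ σ⁻ φ w w⁺ w⁻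
WF-subst σ⁺ σ⁻ (μ φ)     (w , n) w⁺ w⁻ =
  WF-subst _ _ φ w (WF-liftσ σ⁺ tt w⁺) (WF-liftσ σ⁻ tt w⁻) , NoNeg-Bound-subst σ⁺ σ⁻ φ n
WF-subst σ⁺ σ⁻ (ν φ)     (w , n) w⁺ w⁻ =
  WF-subst _ _ φ w (WF-liftσ σ⁺ tt w⁺) (WF-liftσ σ⁻ tt w⁻) , NoNeg-Bound-subst σ⁺ σ⁻ φ n

plug : Form A PQ → W → Form A W → Form A W
plug θ p′ χ = subst (pq (var p′) χ) (pq (neg p′) ff) θ

NoNeg-plug : {P : PQ → Set} {Q : W → Set} {p′ : W} → P q → ¬ Q p′ →
  (θ : Form A PQ) → NoNeg P θ → (χ : Form A W) → NoNeg Q χ → NoNeg Q (plug θ p′ χ)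
NoNeg-plug Pq ¬Qp′ θ nθ χ nχ = NoNeg-subst _ _ θ nθ
  (λ { p → tt ; q → nχ })
  (λ { p _ → ¬Qp′ ; q ¬Pq → ⊥-elim (¬Pq Pq) })

WF-plug : {p′ : W} (θ : Form A PQ) → WF θ → (χ : Form A W) → WF χ → WF (plug θ p′ χ)
WF-plug θ wθ χ wχ = WF-subst _ _ θ wθ (λ { p → tt ; q → wχ }) (λ { p → tt ; q → tt })

module Semantics (em : ExcludedMiddle (suc 0ℓ)) {A : Set} (𝔉 : Frame A) where
  open Classical em

  private
    S = Carrier 𝔉
    variable
      ρ ρ′ : V → Sub S
      X : Sub S

  ⟦_⟧ : Form A V → (V → Sub S) → Sub S
  ⟦ var x ⟧   ρ = ρ x
  ⟦ neg x ⟧   ρ = ∁ (ρ x)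
  ⟦ tt ⟧      ρ = λ _ → ⊤
  ⟦ φ ∧ χ ⟧   ρ = ⟦ φ ⟧ ρ ∩ ⟦ χ ⟧ ρ
  ⟦ ff ⟧      ρ = λ _ → ⊥
  ⟦ φ ∨ χ ⟧   ρ = ⟦ φ ⟧ ρ ∪ ⟦ χ ⟧ ρ
  ⟦ ⟨ a ⟩ φ ⟧ ρ = ◇ (R 𝔉 a) (⟦ φ ⟧ ρ)
  ⟦ [ a ] φ ⟧ ρ = □ (R 𝔉 a) (⟦ φ ⟧ ρ)
  ⟦ μ φ ⟧     ρ = lfp λ Y → ⟦ φ ⟧ (ρ [↦ Y ])
  ⟦ ν φ ⟧     ρ = gfp λ Y → ⟦ φ ⟧ (ρ [↦ Y ])

  ⟦⟧-mono : (φ : Form A V) {P : V → Set} → NoNeg P φ →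
    (∀ x → ρ x ⊆ ρ′ x) → (∀ x → ¬ P x → ρ′ x ⊆ ρ x) → ⟦ φ ⟧ ρ ⊆ ⟦ φ ⟧ ρ′
  ⟦⟧-mono (var x)   _       up down = up x
  ⟦⟧-mono (neg x)   ¬Px     up down = λ ¬ρx ρ′x → ¬ρx (down x ¬Px ρ′x)
  ⟦⟧-mono tt        _       up down = id
  ⟦⟧-mono (φ ∧ χ)   (n , m) up down = Product.map (⟦⟧-mono φ n up down) (⟦⟧-mono χ m up down)
  ⟦⟧-mono ff        _       up down = id
  ⟦⟧-mono (φ ∨ χ)   (n , m) up down = Sum.map (⟦⟧-mono φ n up down) (⟦⟧-mono χ m up down)
  ⟦⟧-mono (⟨ a ⟩ φ) n       up down = ◇-mono (R 𝔉 a) (⟦⟧-mono φ n up down)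
  ⟦⟧-mono ([ a ] φ) n       up down = □-mono (R 𝔉 a) (⟦⟧-mono φ n up down)
  ⟦⟧-mono (μ φ)     n       up down = lfp-mono λ Y → ⟦⟧-mono φ n ([↦]-⊆ up) ([↦]-⊇ down)
  ⟦⟧-mono (ν φ)     n       up down = gfp-mono λ Y → ⟦⟧-mono φ n ([↦]-⊆ up) ([↦]-⊇ down)

  body-mono : (φ : Form A (Maybe V)) → NoNeg Bound φ → (ρ : V → Sub S) →
    (λ Y → ⟦ φ ⟧ (ρ [↦ Y ])) Preserves _⊆_ ⟶ _⊆_
  body-mono φ n ρ Y⊆Z = ⟦⟧-mono φ n
    (λ { nothing → Y⊆Z ; (just x) → id })
    (λ { nothing ¬b → ⊥-elim (¬b tt) ; (just x) _ → id })

  ⟦rename⟧ : (f : V → W) (φ : Form A V) → (∀ x → ρ (f x) ≈ ρ′ x) → ⟦ rename f φ ⟧ ρ ≈ ⟦ φ ⟧ ρ′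
  ⟦rename⟧ f (var x)   ρ≈ρ′ = ρ≈ρ′ x
  ⟦rename⟧ f (neg x)   ρ≈ρ′ = ∁-cong (ρ≈ρ′ x)
  ⟦rename⟧ f tt        ρ≈ρ′ = ≈-refl
  ⟦rename⟧ f (φ ∧ χ)   ρ≈ρ′ = ∩-cong (⟦rename⟧ f φ ρ≈ρ′) (⟦rename⟧ f χ ρ≈ρ′)
  ⟦rename⟧ f ff        ρ≈ρ′ = ≈-refl
  ⟦rename⟧ f (φ ∨ χ)   ρ≈ρ′ = ∪-cong (⟦rename⟧ f φ ρ≈ρ′) (⟦rename⟧ f χ ρ≈ρ′)
  ⟦rename⟧ f (⟨ a ⟩ φ) ρ≈ρ′ = ◇-cong (R 𝔉 a) (⟦rename⟧ f φ ρ≈ρ′)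
  ⟦rename⟧ f ([ a ] φ) ρ≈ρ′ = □-cong (R 𝔉 a) (⟦rename⟧ f φ ρ≈ρ′)
  ⟦rename⟧ f (μ φ)     ρ≈ρ′ =
    lfp-cong λ Y → ⟦rename⟧ (mapMaybe f) φ λ { nothing → ≈-refl ; (just x) → ρ≈ρ′ x }
  ⟦rename⟧ f (ν φ)     ρ≈ρ′ =
    gfp-cong λ Y → ⟦rename⟧ (mapMaybe f) φ λ { nothing → ≈-refl ; (just x) → ρ≈ρ′ x }

  module _ {Y : Sub S} where

    ⟦liftσ⁺⟧ : (σ⁺ : V → Form A W) → (∀ x → ⟦ σ⁺ x ⟧ ρ ≈ ρ′ x) →
      ∀ y → ⟦ liftσ var σ⁺ y ⟧ (ρ [↦ Y ]) ≈ (ρ′ [↦ Y ]) y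
    ⟦liftσ⁺⟧ σ⁺ σ⁺≈ nothing  = ≈-refl
    ⟦liftσ⁺⟧ σ⁺ σ⁺≈ (just x) = ≈-trans (⟦rename⟧ just (σ⁺ x) λ _ → ≈-refl) (σ⁺≈ x)

    ⟦liftσ⁻⟧ : {P : V → Set} (σ⁻ : V → Form A W) → (∀ x → ¬ P x → ⟦ σ⁻ x ⟧ ρ ≈ ∁ (ρ′ x)) →
      ∀ y → ¬ liftP P y → ⟦ liftσ neg σ⁻ y ⟧ (ρ [↦ Y ]) ≈ ∁ ((ρ′ [↦ Y ]) y)
    ⟦liftσ⁻⟧ σ⁻ σ⁻≈ nothing  _   = ≈-refl
    ⟦liftσ⁻⟧ σ⁻ σ⁻≈ (just x) ¬Px = ≈-trans (⟦rename⟧ just (σ⁻ x) λ _ → ≈-refl) (σ⁻≈ x ¬Px)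

  ⟦subst⟧ : (σ⁺ σ⁻ : V → Form A W) (φ : Form A V) {P : V → Set} → NoNeg P φ →
    (∀ x → ⟦ σ⁺ x ⟧ ρ ≈ ρ′ x) → (∀ x → ¬ P x → ⟦ σ⁻ x ⟧ ρ ≈ ∁ (ρ′ x)) →
    ⟦ subst σ⁺ σ⁻ φ ⟧ ρ ≈ ⟦ φ ⟧ ρ′
  ⟦subst⟧ σ⁺ σ⁻ (var x)   n       σ⁺≈ σ⁻≈ = σ⁺≈ x
  ⟦subst⟧ σ⁺ σ⁻ (neg x)   ¬Px     σ⁺≈ σ⁻≈ = σ⁻≈ x ¬Px
  ⟦subst⟧ σ⁺ σ⁻ tt        n       σ⁺≈ σ⁻≈ = ≈-refl
  ⟦subst⟧ σ⁺ σ⁻ (φ ∧ χ)   (n , m) σ⁺≈ σ⁻≈ =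
    ∩-cong (⟦subst⟧ σ⁺ σ⁻ φ n σ⁺≈ σ⁻≈) (⟦subst⟧ σ⁺ σ⁻ χ m σ⁺≈ σ⁻≈)
  ⟦subst⟧ σ⁺ σ⁻ ff        n       σ⁺≈ σ⁻≈ = ≈-refl
  ⟦subst⟧ σ⁺ σ⁻ (φ ∨ χ)   (n , m) σ⁺≈ σ⁻≈ =
    ∪-cong (⟦subst⟧ σ⁺ σ⁻ φ n σ⁺≈ σ⁻≈) (⟦subst⟧ σ⁺ σ⁻ χ m σ⁺≈ σ⁻≈)
  ⟦subst⟧ σ⁺ σ⁻ (⟨ a ⟩ φ) n       σ⁺≈ σ⁻≈ = ◇-cong (R 𝔉 a) (⟦subst⟧ σ⁺ σ⁻ φ n σ⁺≈ σ⁻≈)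
  ⟦subst⟧ σ⁺ σ⁻ ([ a ] φ) n       σ⁺≈ σ⁻≈ = □-cong (R 𝔉 a) (⟦subst⟧ σ⁺ σ⁻ φ n σ⁺≈ σ⁻≈)
  ⟦subst⟧ σ⁺ σ⁻ (μ φ)     n       σ⁺≈ σ⁻≈ = lfp-cong λ Y →
    ⟦subst⟧ (liftσ var σ⁺) (liftσ neg σ⁻) φ n (⟦liftσ⁺⟧ σ⁺ σ⁺≈) (⟦liftσ⁻⟧ σ⁻ σ⁻≈)
  ⟦subst⟧ σ⁺ σ⁻ (ν φ)     n       σ⁺≈ σ⁻≈ = gfp-cong λ Y →
    ⟦subst⟧ (liftσ var σ⁺) (liftσ neg σ⁻) φ n (⟦liftσ⁺⟧ σ⁺ σ⁺≈) (⟦liftσ⁻⟧ σ⁻ σ⁻≈)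

  ⟦plug⟧ : {P : PQ → Set} → P q → (θ : Form A PQ) → NoNeg P θ → {p′ : W} {T : Sub S} →
    ρ p′ ≈ T → (χ : Form A W) → ⟦ plug θ p′ χ ⟧ ρ ≈ ⟦ θ ⟧ (pq T (⟦ χ ⟧ ρ))
  ⟦plug⟧ Pq θ n p′≈T χ = ⟦subst⟧ _ _ θ n
    (λ { p → p′≈T ; q → ≈-refl })
    (λ { p _ → ∁-cong p′≈T ; q ¬Pq → ⊥-elim (¬Pq Pq) })

  Sem⇒≈⟦⟧ : (φ : Form A V) → WF φ → Sem 𝔉 φ ρ X → X ≈ ⟦ φ ⟧ ρ
  ≈⟦⟧⇒Sem : {ρ : V → Sub S} {X : Sub S} (φ : Form A V) → WF φ → X ≈ ⟦ φ ⟧ ρ → Sem 𝔉 φ ρ X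

  Sem-⟦⟧ : (φ : Form A V) → WF φ → Sem 𝔉 φ ρ (⟦ φ ⟧ ρ)
  Sem-⟦⟧ φ w = ≈⟦⟧⇒Sem φ w ≈-refl

  Sem⇒≈⟦⟧ (var x)   _       (lift X≐) = ≐⇒≈ X≐
  Sem⇒≈⟦⟧ (neg x)   _       (lift X≐) = ≐⇒≈ X≐
  Sem⇒≈⟦⟧ tt        _       (lift X≐) = ≐⇒≈ X≐
  Sem⇒≈⟦⟧ ff        _       (lift X≐) = ≐⇒≈ X≐
  Sem⇒≈⟦⟧ (φ ∧ χ)   (w , u) (_ , _ , sφ , sχ , lift X≐) =
    ≈-trans (≐⇒≈ X≐) (∩-cong (Sem⇒≈⟦⟧ φ w sφ) (Sem⇒≈⟦⟧ χ u sχ))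
  Sem⇒≈⟦⟧ (φ ∨ χ)   (w , u) (_ , _ , sφ , sχ , lift X≐) =
    ≈-trans (≐⇒≈ X≐) (∪-cong (Sem⇒≈⟦⟧ φ w sφ) (Sem⇒≈⟦⟧ χ u sχ))
  Sem⇒≈⟦⟧ (⟨ a ⟩ φ) w       (_ , sφ , lift X≐) = ≈-trans (≐⇒≈ X≐) (◇-cong (R 𝔉 a) (Sem⇒≈⟦⟧ φ w sφ))
  Sem⇒≈⟦⟧ ([ a ] φ) w       (_ , sφ , lift X≐) = ≈-trans (≐⇒≈ X≐) (□-cong (R 𝔉 a) (Sem⇒≈⟦⟧ φ w sφ))
  Sem⇒≈⟦⟧ (μ φ)     (w , _) ((_ , sX′ , lift X′≐X) , least) =
      (λ x → lfp-intro λ Y ΦY⊆Y → lower (least Y _ (Sem-⟦⟧ φ w)) (λ _ → ΦY⊆Y) _ x)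
    , lfp-induction (proj₁ (≈-trans (≈-sym (Sem⇒≈⟦⟧ φ w sX′)) (≐⇒≈ X′≐X)))
  Sem⇒≈⟦⟧ (ν φ)     (w , _) ((_ , sX′ , lift X′≐X) , greatest) =
      gfp-coinduction (proj₁ (≈-trans (≈-sym (≐⇒≈ X′≐X)) (Sem⇒≈⟦⟧ φ w sX′)))
    , λ x → let (Y , Y⊆ΦY , y) = gfp-elim x in
        lower (greatest Y _ (Sem-⟦⟧ φ w)) (λ _ → Y⊆ΦY) _ y

  ≈⟦⟧⇒Sem (var x)   _       X≈ = lift (≈⇒≐ X≈)
  ≈⟦⟧⇒Sem (neg x)   _       X≈ = lift (≈⇒≐ X≈)
  ≈⟦⟧⇒Sem tt        _       X≈ = lift (≈⇒≐ X≈)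
  ≈⟦⟧⇒Sem ff        _       X≈ = lift (≈⇒≐ X≈)
  ≈⟦⟧⇒Sem (φ ∧ χ)   (w , u) X≈ = _ , _ , Sem-⟦⟧ φ w , Sem-⟦⟧ χ u , lift (≈⇒≐ X≈)
  ≈⟦⟧⇒Sem (φ ∨ χ)   (w , u) X≈ = _ , _ , Sem-⟦⟧ φ w , Sem-⟦⟧ χ u , lift (≈⇒≐ X≈)
  ≈⟦⟧⇒Sem (⟨ a ⟩ φ) w       X≈ = _ , Sem-⟦⟧ φ w , lift (≈⇒≐ X≈)
  ≈⟦⟧⇒Sem ([ a ] φ) w       X≈ = _ , Sem-⟦⟧ φ w , lift (≈⇒≐ X≈)
  ≈⟦⟧⇒Sem {ρ = ρ} {X = X} (μ φ) (w , n) X≈ =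
      (_ , Sem-⟦⟧ φ w , lift (≈⇒≐ ΦX≈X))
    , λ Y Y′ sY′ → lift λ Y′⊆Y _ x →
        lfp-induction (λ y → Y′⊆Y _ (proj₂ (Sem⇒≈⟦⟧ φ w sY′) y)) (proj₁ X≈ x)
    where
    ΦX≈X : ⟦ φ ⟧ (ρ [↦ X ]) ≈ X
    ΦX≈X = ≈-trans (mono⇒cong (body-mono φ n ρ) X≈)
                   (≈-trans (lfp-fixed (body-mono φ n ρ)) (≈-sym X≈))
  ≈⟦⟧⇒Sem {ρ = ρ} {X = X} (ν φ) (w , n) X≈ =
      (_ , Sem-⟦⟧ φ w , lift (≈⇒≐ ΦX≈X))
    , λ Y Y′ sY′ → lift λ Y⊆Y′ _ y →
        proj₂ X≈ (gfp-coinduction (λ y → proj₁ (Sem⇒≈⟦⟧ φ w sY′) (Y⊆Y′ _ y)) y)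
    where
    ΦX≈X : ⟦ φ ⟧ (ρ [↦ X ]) ≈ X
    ΦX≈X = ≈-trans (mono⇒cong (body-mono φ n ρ) X≈)
                   (≈-trans (gfp-fixed (body-mono φ n ρ)) (≈-sym X≈))

module _ (ψ ψop : B → Form A PQ)
         (ψ-positive : ∀ b → NoNeg (λ _ → ⊤) (ψ b))
         (ψop-positive-in-q : ∀ b → NoNeg (_≡ q) (ψop b)) where

  NoNeg-tr : {P : V → Set} {Q : W → Set} (e : V → W) (p′ : W) → ¬ Q p′ →
    (∀ x → Q (e x) → P x) → (φ : Form B V) → NoNeg P φ → NoNeg Q (tr ψ ψop e p′ φ)
  NoNeg-tr e p′ ¬Qp′ Q⇒P (var x)   n       = tt , tt
  NoNeg-tr e p′ ¬Qp′ Q⇒P (neg x)   ¬Px     = tt , ¬Px ∘ Q⇒P x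
  NoNeg-tr e p′ ¬Qp′ Q⇒P tt        n       = tt
  NoNeg-tr e p′ ¬Qp′ Q⇒P (φ ∧ χ)   (n , m) = NoNeg-tr e p′ ¬Qp′ Q⇒P φ n , NoNeg-tr e p′ ¬Qp′ Q⇒P χ m
  NoNeg-tr e p′ ¬Qp′ Q⇒P ff        n       = tt
  NoNeg-tr e p′ ¬Qp′ Q⇒P (φ ∨ χ)   (n , m) = NoNeg-tr e p′ ¬Qp′ Q⇒P φ n , NoNeg-tr e p′ ¬Qp′ Q⇒P χ m
  NoNeg-tr e p′ ¬Qp′ Q⇒P (⟨ b ⟩ φ) n       =
    NoNeg-plug tt ¬Qp′ (ψ b) (ψ-positive b) _ (NoNeg-tr e p′ ¬Qp′ Q⇒P φ n)
  NoNeg-tr e p′ ¬Qp′ Q⇒P ([ b ] φ) n       =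
    tt , NoNeg-plug refl ¬Qp′ (ψop b) (ψop-positive-in-q b) _ (NoNeg-tr e p′ ¬Qp′ Q⇒P φ n)
  NoNeg-tr e p′ ¬Qp′ Q⇒P (μ φ)     n       =
    NoNeg-tr (mapMaybe e) (just p′) ¬Qp′ (liftP-comap e Q⇒P) φ n
  NoNeg-tr e p′ ¬Qp′ Q⇒P (ν φ)     n       =
    NoNeg-tr (mapMaybe e) (just p′) ¬Qp′ (liftP-comap e Q⇒P) φ n

  module _ (ψ-wf : ∀ b → WF (ψ b)) (ψop-wf : ∀ b → WF (ψop b)) where

    WF-tr : (e : V → W) (p′ : W) (φ : Form B V) → WF φ → WF (tr ψ ψop e p′ φ)
    WF-tr e p′ (var x)   w       = tt , tt
    WF-tr e p′ (neg x)   w       = tt , tt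
    WF-tr e p′ tt        w       = tt
    WF-tr e p′ (φ ∧ χ)   (w , u) = WF-tr e p′ φ w , WF-tr e p′ χ u
    WF-tr e p′ ff        w       = tt
    WF-tr e p′ (φ ∨ χ)   (w , u) = WF-tr e p′ φ w , WF-tr e p′ χ u
    WF-tr e p′ (⟨ b ⟩ φ) w       = WF-plug (ψ b) (ψ-wf b) _ (WF-tr e p′ φ w)
    WF-tr e p′ ([ b ] φ) w       = tt , WF-plug (ψop b) (ψop-wf b) _ (WF-tr e p′ φ w)
    WF-tr e p′ (μ φ)     (w , n) =
      WF-tr (mapMaybe e) (just p′) φ w ,
      NoNeg-tr (mapMaybe e) (just p′) (λ ()) (Bound-mapMaybe e) φ n
    WF-tr e p′ (ν φ)     (w , n) =
      WF-tr (mapMaybe e) (just p′) φ w ,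
      NoNeg-tr (mapMaybe e) (just p′) (λ ()) (Bound-mapMaybe e) φ n

module Translation (em : ExcludedMiddle (suc 0ℓ)) (𝔉 : Frame A) (𝔊 : Frame B)
  (ι : Carrier 𝔊 → Carrier 𝔉) (ι-injective : Injective _≡_ _≡_ ι)
  (ψ ψop : B → Form A PQ) (ψ-wf : ∀ b → InLμpq (ψ b))
  (ψop-wf : ∀ b → WF (ψop b) × NoNeg (_≡ q) (ψop b) × IsOp 𝔉 (ψ b) (ψop b))
  (p-defined : PDefined 𝔉 𝔊 ι ψ) where

  open Classical em
  open Image ι
  open Embedding ι-injective
  module 𝔉ₛ = Semantics em 𝔉
  module 𝔊ₛ = Semantics em 𝔊
  open SetoidReasoning (≐-setoid (Carrier 𝔉) 0ℓ)

  private
    variable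
      ρG : V → Sub (Carrier 𝔊)
      ρF : W → Sub (Carrier 𝔉)
      e : V → W
      p′ : W

  ⟦ψ⟧≈image◇ : ∀ b (T : Sub (Carrier 𝔉)) →
    𝔉ₛ.⟦ ψ b ⟧ (pq range T) ≈ image ι (◇ (R 𝔊 b) (T ∘ ι))
  ⟦ψ⟧≈image◇ b T = ≈-trans (≈-sym (𝔉ₛ.Sem⇒≈⟦⟧ (ψ b) (proj₁ (ψ-wf b)) (p-defined b T)))
                            (image-cong (Product.map₂ Product.swap , Product.map₂ Product.swap))

  ⟦ψop⟧≈image□ : ∀ b (T : Sub (Carrier 𝔉)) →
    range ∩ 𝔉ₛ.⟦ ψop b ⟧ (pq range T) ≈ image ι (□ (R 𝔊 b) (T ∘ ι))
  ⟦ψop⟧≈image□ b T = begin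
    range ∩ O                                    ≈⟨ ∩-cong ≈-refl ∁∁ ⟨
    range ∩ ∁ (∁ O)                              ≈⟨ ∩-cong ≈-refl (∁-cong ∁O≈) ⟩
    range ∩ ∁ (image ι (◇ (R 𝔊 b) (∁ T ∘ ι)))   ≈⟨ image-□ ι ι-injective ⟩
    image ι (□ (R 𝔊 b) (T ∘ ι))                  ∎
    where
    O = 𝔉ₛ.⟦ ψop b ⟧ (pq range T)
    τ⁺ τ⁻ : PQ → Form A PQ
    τ⁺ = pq (var p) (neg q)
    τ⁻ = pq (neg p) (var q)
    ψ¬q = subst τ⁺ τ⁻ (ψ b)
    ψ¬q-wf : WF ψ¬q
    ψ¬q-wf = WF-subst τ⁺ τ⁻ (ψ b) (proj₁ (ψ-wf b)) (λ { p → tt ; q → tt }) (λ { p → tt ; q → tt })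
    ψ¬q-sem : Sem 𝔉 ψ¬q (pq range T) (∁ O)
    ψ¬q-sem = Equivalence.to (proj₂ (proj₂ (ψop-wf b)) (pq range T) O)
                             (𝔉ₛ.Sem-⟦⟧ (ψop b) (proj₁ (ψop-wf b)))
    ∁O≈ : ∁ O ≈ image ι (◇ (R 𝔊 b) (∁ T ∘ ι))
    ∁O≈ = begin
      ∁ O                             ≈⟨ 𝔉ₛ.Sem⇒≈⟦⟧ ψ¬q ψ¬q-wf ψ¬q-sem ⟩
      𝔉ₛ.⟦ ψ¬q ⟧ (pq range T)         ≈⟨ 𝔉ₛ.⟦subst⟧ τ⁺ τ⁻ (ψ b) (proj₂ (ψ-wf b))
                                          (λ { p → ≈-refl ; q → ≈-refl }) (λ _ ¬⊤ → ⊥-elim (¬⊤ tt)) ⟩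
      𝔉ₛ.⟦ ψ b ⟧ (pq range (∁ T))     ≈⟨ ⟦ψ⟧≈image◇ b (∁ T) ⟩
      image ι (◇ (R 𝔊 b) (∁ T ∘ ι))   ∎

  record Agree (ρG : V → Sub (Carrier 𝔊)) (ρF : W → Sub (Carrier 𝔉))
               (e : V → W) (p′ : W) : Set where
    field
      at-p   : ρF p′ ≈ range
      at-var : ∀ x → image ι (ρG x) ≈ range ∩ ρF (e x)

  extend : Agree ρG ρF e p′ → {Y : Sub (Carrier 𝔊)} {Z : Sub (Carrier 𝔉)} →
    image ι Y ≈ range ∩ Z → Agree (ρG [↦ Y ]) (ρF [↦ Z ]) (mapMaybe e) (just p′)
  extend agree Y≈Z = record
    { at-p   = Agree.at-p agree
    ; at-var = λ { nothing → Y≈Z ; (just x) → Agree.at-var agree x }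
    }

  image-⟦⟧≈⟦tr⟧ : (φ : Form B V) → WF φ → Agree ρG ρF e p′ →
    image ι (𝔊ₛ.⟦ φ ⟧ ρG) ≈ 𝔉ₛ.⟦ tr ψ ψop e p′ φ ⟧ ρF
  image-⟦⟧≈⟦tr⟧ (var x) _ agree = ≈-trans (at-var x) (∩-cong (≈-sym at-p) ≈-refl)
    where open Agree agree
  image-⟦⟧≈⟦tr⟧ (neg x) _ agree = ≈-trans (image-∁ (at-var x)) (∩-cong (≈-sym at-p) ≈-refl)
    where open Agree agree
  image-⟦⟧≈⟦tr⟧ tt _ agree = ≈-sym (Agree.at-p agree)
  image-⟦⟧≈⟦tr⟧ ff _ agree = image-∅
  image-⟦⟧≈⟦tr⟧ (φ ∧ χ) (w , u) agree =
    ≈-trans image-∩ (∩-cong (image-⟦⟧≈⟦tr⟧ φ w agree) (image-⟦⟧≈⟦tr⟧ χ u agree))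
  image-⟦⟧≈⟦tr⟧ (φ ∨ χ) (w , u) agree =
    ≈-trans image-∪ (∪-cong (image-⟦⟧≈⟦tr⟧ φ w agree) (image-⟦⟧≈⟦tr⟧ χ u agree))
  image-⟦⟧≈⟦tr⟧ {ρG = ρG} {ρF = ρF} {e = e} {p′ = p′} (⟨ b ⟩ φ) w agree = begin
    image ι (◇ (R 𝔊 b) (𝔊ₛ.⟦ φ ⟧ ρG))  ≈⟨ image-cong (◇-cong (R 𝔊 b) (image≈⇒≈preimage IH)) ⟩
    image ι (◇ (R 𝔊 b) (T ∘ ι))        ≈⟨ ⟦ψ⟧≈image◇ b T ⟨
    𝔉ₛ.⟦ ψ b ⟧ (pq range T)            ≈⟨ 𝔉ₛ.⟦plug⟧ tt (ψ b) (proj₂ (ψ-wf b)) (Agree.at-p agree) _ ⟨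
    𝔉ₛ.⟦ plug (ψ b) p′ (tr ψ ψop e p′ φ) ⟧ ρF ∎
    where
    IH = image-⟦⟧≈⟦tr⟧ φ w agree
    T = 𝔉ₛ.⟦ tr ψ ψop e p′ φ ⟧ ρF
  image-⟦⟧≈⟦tr⟧ {ρG = ρG} {ρF = ρF} {e = e} {p′ = p′} ([ b ] φ) w agree = begin
    image ι (□ (R 𝔊 b) (𝔊ₛ.⟦ φ ⟧ ρG))  ≈⟨ image-cong (□-cong (R 𝔊 b) (image≈⇒≈preimage IH)) ⟩
    image ι (□ (R 𝔊 b) (T ∘ ι))        ≈⟨ ⟦ψop⟧≈image□ b T ⟨
    range ∩ 𝔉ₛ.⟦ ψop b ⟧ (pq range T)  ≈⟨ ∩-cong at-p
                                            (𝔉ₛ.⟦plug⟧ refl (ψop b) (proj₁ (proj₂ (ψop-wf b))) at-p _) ⟨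
    ρF p′ ∩ 𝔉ₛ.⟦ plug (ψop b) p′ (tr ψ ψop e p′ φ) ⟧ ρF ∎
    where
    open Agree agree
    IH = image-⟦⟧≈⟦tr⟧ φ w agree
    T = 𝔉ₛ.⟦ tr ψ ψop e p′ φ ⟧ ρF
  image-⟦⟧≈⟦tr⟧ {ρG = ρG} (μ φ) (w , n) agree =
    image-lfp ι (𝔊ₛ.body-mono φ n ρG) λ Y≈Z → image-⟦⟧≈⟦tr⟧ φ w (extend agree Y≈Z)
  image-⟦⟧≈⟦tr⟧ {ρG = ρG} (ν φ) (w , n) agree =
    image-gfp ι ι-injective (𝔊ₛ.body-mono φ n ρG) λ Y≈Z → image-⟦⟧≈⟦tr⟧ φ w (extend agree Y≈Z)

proposition6p6 :
    -- ambient classical logic of the paper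
    ExcludedMiddle (suc 0ℓ) →
    {A B P : Set} (𝔉 : Frame A) (𝔊 : Frame B)
    -- G ⊆ F
    (ι : Carrier 𝔊 → Carrier 𝔉) → Injective _≡_ _≡_ ι →
    -- Ψ = {ψ_b} ⊆ L_μ[p,q], together with the formulas ψ_b^op
    (ψ ψop : B → Form A PQ) →
    (∀ b → InLμpq (ψ b)) →
    (∀ b → WF (ψop b) × NoNeg (λ x → x ≡ q) (ψop b) × IsOp 𝔉 (ψ b) (ψop b)) →
    -- 𝒢 is p-defined in 𝓕 by Ψ
    PDefined 𝔉 𝔊 ι ψ →
    (v : P → Sub (Carrier 𝔉)) (φ : Form B P) → WF φ →
    -- [[φ]]_{𝒢_{π∘v}} = [[tr_Ψ(φ)]]_{𝓕_v[p↦G]}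
    ((X : Sub (Carrier 𝔊)) → Sem 𝔊 φ (π∘ ι v) X →
      Sem 𝔉 (trΨ ψ ψop φ) (v [p↦ image ι (λ _ → ⊤) ]) (image ι X))
    × ((Z : Sub (Carrier 𝔉)) → Sem 𝔉 (trΨ ψ ψop φ) (v [p↦ image ι (λ _ → ⊤) ]) Z →
      Σ (Sub (Carrier 𝔊)) λ X → Sem 𝔊 φ (π∘ ι v) X × (image ι X ≐ Z))
proposition6p6 em 𝔉 𝔊 ι ι-injective ψ ψop ψ-wf ψop-wf p-defined v φ wf =
  (λ X sX → 𝔉ₛ.≈⟦⟧⇒Sem _ trφ-wf (≈-trans (image-cong (𝔊ₛ.Sem⇒≈⟦⟧ φ wf sX)) ⟦φ⟧≈⟦trφ⟧)) ,
  (λ Z sZ → _ , 𝔊ₛ.Sem-⟦⟧ φ wf , ≈⇒≐ (≈-trans ⟦φ⟧≈⟦trφ⟧ (≈-sym (𝔉ₛ.Sem⇒≈⟦⟧ _ trφ-wf sZ))))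
  where
  open Image ι
  open Translation em 𝔉 𝔊 ι ι-injective ψ ψop ψ-wf ψop-wf p-defined

  agree : Agree (π∘ ι v) (v [p↦ range ]) just nothing
  agree = record { at-p = ≈-refl ; at-var = image-preimage ∘ v }

  ⟦φ⟧≈⟦trφ⟧ : image ι (𝔊ₛ.⟦ φ ⟧ (π∘ ι v)) ≈ 𝔉ₛ.⟦ trΨ ψ ψop φ ⟧ (v [p↦ range ])
  ⟦φ⟧≈⟦trφ⟧ = image-⟦⟧≈⟦tr⟧ φ wf agree

  trφ-wf : WF (trΨ ψ ψop φ)
  trφ-wf = WF-tr ψ ψop (proj₂ ∘ ψ-wf) (proj₁ ∘ proj₂ ∘ ψop-wf) (proj₁ ∘ ψ-wf) (proj₁ ∘ ψop-wf)
                 just nothing φ wf
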